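{- Let $a,b$ be distinct values from $\{6,7,8\}$. Call a triple $(G,H,F)$ a counterexample if $G$ is a planar graph with no cycles of length $4$, $a$, $b$, or $9$, $H$ is a cover of $G$ with colors $1,\dots,s$ for some $s\ge1$, $F=(f_1,\dots,f_s)$ with $f_i(v)\in\{0,1,2\}$ and $|f(v)|\ge 3$ for every vertex $v$ and every $i$, and $(G,H)$ has no DP-$F$-coloring. If $(G,H,F)$ is a counterexample with $|V(G)|$ minimum among all counterexamples, then every vertex of $G$ has degree at least $3$.
   Context: All graphs are finite, simple and undirected. For a positive integer $s$, a cover of $G$ with colors $1,\dots,s$ is a graph $H$ with vertex set $V(G)\times\{1,\dots,s\}$ such that: each $\{u\}\times\{1,\dots,s\}$ induces a complete graph; for each edge $uv\in E(G)$ the edges of $H$ between $\{u\}\times\{1,\dots,s\}$ and $\{v\}\times\{1,\dots,s\}$ form a (possibly empty) matching; if $uv\notin E(G)$ there are no such edges. $|f(v)|=f_1(v)+\cdots+f_s(v)$. A representative set contains exactly one element of $\{v\}\times\{1,\dots,s\}$ for each $v$. A DP-$F$-coloring of $(G,H)$ is a representative set $R$ that can be linearly ordered so that each $(v,i)\in R$ has fewer than $f_i(v)$ neighbors in $H$ among the elements of $R$ preceding it. -}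

module Defs where

open import Data.Nat as ℕ using (ℕ; zero; suc; _<ᵇ_; NonZero)
open import Data.Nat.DivMod using (_%_; m%n<n)
open import Data.Bool using (Bool; true; false; if_then_else_; _∧_)
open import Data.Fin as Fin using (Fin; toℕ; fromℕ<)
open import Data.List using (List; map; allFin)
open import Data.Nat.ListAction using (sum)
open import Data.Product using (Σ; _×_; _,_; ∃)
open import Data.Rational as ℚ using (ℚ; 0ℚ; 1ℚ)
open import Relation.Binary.PropositionalEquality using (_≡_; _≢_)
open import Relation.Nullary using (¬_)
open import Function.Definitions using (Injective)

record Graph (n : ℕ) : Set where
  field
    adj    : Fin n → Fin n → Bool
    sym    : ∀ u v → adj u v ≡ adj v u
    irrefl : ∀ v → adj v v ≡ false
open Graph public

countFin : ∀ {n} → (Fin n → Bool) → ℕ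
countFin {n} p = sum (map (λ u → if p u then 1 else 0) (allFin n))

degree : ∀ {n} → Graph n → Fin n → ℕ
degree G v = countFin (adj G v)

nextMod : ∀ {k} .{{_ : NonZero k}} → Fin k → Fin k
nextMod {k} i = fromℕ< (m%n<n (suc (toℕ i)) k)

-- A cycle of length k (k ≥ 3): an injective map c : Fin k → V with
-- c i adjacent to c (i+1 mod k) for all i.  Lengths < 3 give no cycles.
HasCycle : ∀ {n} → Graph n → ℕ → Set
HasCycle {n} G k@(suc (suc (suc _))) =
  Σ (Fin k → Fin n) λ c →
    Injective _≡_ _≡_ c × (∀ i → adj G (c i) (c (nextMod i)) ≡ true)
HasCycle G _ = 0 ≡ 1

-- Planarity, via non-crossing straight-line drawings in ℚ²

Point : Set
Point = ℚ × ℚ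

OnSegment : Point → Point → Point → Set
OnSegment (p₁ , p₂) (q₁ , q₂) (x₁ , x₂) =
  ∃ λ (t : ℚ) → (0ℚ ℚ.≤ t) × (t ℚ.≤ 1ℚ) ×
    (x₁ ≡ p₁ ℚ.+ t ℚ.* (q₁ ℚ.- p₁)) × (x₂ ≡ p₂ ℚ.+ t ℚ.* (q₂ ℚ.- p₂))

SegmentsMeet : Point → Point → Point → Point → Set
SegmentsMeet p q r s = ∃ λ x → OnSegment p q x × OnSegment r s x

record PlaneDrawing {n} (G : Graph n) : Set where
  field
    pos        : Fin n → Point
    pos-inj    : Injective _≡_ _≡_ pos
    vert-off   : ∀ u v w → adj G u v ≡ true → w ≢ u → w ≢ v →
                 ¬ OnSegment (pos u) (pos v) (pos w)
    no-cross   : ∀ u v x y → adj G u v ≡ true → adj G x y ≡ true →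
                 u ≢ x → u ≢ y → v ≢ x → v ≢ y →
                 ¬ SegmentsMeet (pos u) (pos v) (pos x) (pos y)

Planar : ∀ {n} → Graph n → Set
Planar G = PlaneDrawing G

record Cover {n} (G : Graph n) (s : ℕ) : Set where
  field
    hadj     : Fin n × Fin s → Fin n × Fin s → Bool
    hsym     : ∀ x y → hadj x y ≡ hadj y x
    hirrefl  : ∀ x → hadj x x ≡ false
    fibre    : ∀ u i j → i ≢ j → hadj (u , i) (u , j) ≡ true
    non-edge : ∀ u v i j → u ≢ v → adj G u v ≡ false → hadj (u , i) (v , j) ≡ false
    matching : ∀ u v i j k → u ≢ v → hadj (u , i) (v , j) ≡ true →
               hadj (u , i) (v , k) ≡ true → j ≡ k
open Cover public

fsum : ∀ {n s} → (Fin s → Fin n → ℕ) → Fin n → ℕ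
fsum {s = s} f v = sum (map (λ i → f i v) (allFin s))

-- A DP-F-coloring: a representative set (choice r v of a color at each v)
-- with a linear order (injective position map ord) such that each
-- (v , r v) has fewer than f_{r v}(v) H-neighbours in R preceding it.
DPFColoring : ∀ {n s} (G : Graph n) → Cover G s → (Fin s → Fin n → ℕ) → Set
DPFColoring {n} {s} G H f =
  Σ (Fin n → Fin s) λ r →
  Σ (Fin n → Fin n) λ ord →
    Injective _≡_ _≡_ ord ×
    (∀ v → countFin (λ u → (toℕ (ord u) <ᵇ toℕ (ord v)) ∧ hadj H (v , r v) (u , r u))
             ℕ.< f (r v) v)

record Counterexample (a b : ℕ) : Set where
  field
    n       : ℕ
    G       : Graph n
    planar  : Planar G
    no-C4   : ¬ HasCycle G 4
    no-Ca   : ¬ HasCycle G a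
    no-Cb   : ¬ HasCycle G b
    no-C9   : ¬ HasCycle G 9
    s       : ℕ
    s≥1     : 1 ℕ.≤ s
    H       : Cover G s
    f       : Fin s → Fin n → ℕ
    f≤2     : ∀ i v → f i v ℕ.≤ 2
    |f|≥3   : ∀ v → 3 ℕ.≤ fsum f v
    no-col  : ¬ DPFColoring G H f

{-# OPTIONS --safe #-}
-- A vertex v with deg v < |f(v)| is reducible. Deleting v preserves planarity, the excluded
-- cycles and all conditions on H and F, so by minimality G − v has a DP-F-coloring R′.
-- Put v after all of R′: by the matching condition every colored neighbour of v is
-- H-adjacent to at most one (v , i), so the numbers c_i of colored H-neighbours of (v , i)
-- satisfy Σ c_i ≤ deg v < |f(v)|, and some color i with c_i < f_i(v) is free for v.
module Submission where

open import Defs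
open import Data.Nat using (ℕ; _≤_)
open import Data.Fin using (Fin)
open import Data.Sum using (_⊎_)
open import Relation.Binary.PropositionalEquality using (_≡_; _≢_)

open import Data.Bool using (Bool; true; false; if_then_else_; _∧_)
open import Data.Bool.Properties using (∧-zeroʳ)
open import Data.Fin using (zero; suc; punchIn; punchOut; inject₁; fromℕ; toℕ; _≟_)
open import Data.Fin.Properties
  using (suc-injective; punchIn-injective; punchInᵢ≢i; punchIn-punchOut;
         fromℕ≢inject₁; inject₁-injective; toℕ-fromℕ; toℕ-inject₁; toℕ<n; ¬∀⟶∃¬)
open import Data.List using (map; allFin; tabulate)
open import Data.List.Properties using (map-tabulate)
open import Data.Nat using (zero; suc; _+_; _<_; _<ᵇ_; z≤n)
open import Data.Nat.Properties
  using (+-0-commutativeMonoid; _≤?_; _<?_; ≤-refl; ≤-reflexive; ≤-<-trans; <-≤-trans;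
         +-mono-≤; ≰⇒>; <⇒≱; <⇒≯; module ≤-Reasoning)
import Data.Nat.ListAction as List
open import Data.Product using (∃; _,_; map₁; map₂)
open import Data.Vec.Functional using (insertAt; removeAt)
open import Data.Vec.Functional.Properties using (insertAt-lookup; insertAt-punchIn)
open import Function using (_∘_; id)
open import Function.Definitions using (Injective)
open import Relation.Binary.PropositionalEquality as ≡ using (refl; trans; cong; cong₂; subst; subst₂)
open import Relation.Nullary using (yes; no; contradiction)
open import Relation.Nullary.Decidable using (dec-false)

open import Algebra.Properties.CommutativeMonoid.Sum +-0-commutativeMonoid
  using (sum; sum-syntax; sum-remove; ∑-comm; sum-cong-≗; sum-replicate-zero)

𝟙 : Bool → ℕ
𝟙 b = if b then 1 else 0

sum-tabulate : ∀ {n} (h : Fin n → ℕ) → List.sum (tabulate h) ≡ sum h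
sum-tabulate {zero}  h = refl
sum-tabulate {suc n} h = cong (h zero +_) (sum-tabulate (h ∘ suc))

sum-map-allFin : ∀ {n} (h : Fin n → ℕ) → List.sum (map h (allFin n)) ≡ sum h
sum-map-allFin h = trans (cong List.sum (map-tabulate id h)) (sum-tabulate h)

sum-mono-≤ : ∀ {n} {g h : Fin n → ℕ} → (∀ i → g i ≤ h i) → sum g ≤ sum h
sum-mono-≤ {zero}  _   = z≤n
sum-mono-≤ {suc n} g≤h = +-mono-≤ (g≤h zero) (sum-mono-≤ (g≤h ∘ suc))

sum-<⇒∃-< : ∀ {n} {g h : Fin n → ℕ} → sum g < sum h → ∃ λ i → g i < h i
sum-<⇒∃-< {n} {g} {h} ∑g<∑h =
  map₂ ≰⇒> (¬∀⟶∃¬ n (λ i → h i ≤ g i) (λ i → h i ≤? g i) (<⇒≱ ∑g<∑h ∘ sum-mono-≤))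

sum-𝟙-none : ∀ {n} {p : Fin n → Bool} → (∀ i → p i ≡ false) → sum (𝟙 ∘ p) ≡ 0
sum-𝟙-none {n} none = trans (sum-cong-≗ (cong 𝟙 ∘ none)) (sum-replicate-zero n)

sum-𝟙-unique : ∀ {n} {p : Fin n → Bool} →
  (∀ {i j} → p i ≡ true → p j ≡ true → i ≡ j) → sum (𝟙 ∘ p) ≤ 1
sum-𝟙-unique {zero} _ = z≤n
sum-𝟙-unique {suc n} {p} unique with p zero in p₀
... | true  = ≤-reflexive (cong suc (sum-𝟙-none none))
  where
  none : ∀ i → p (suc i) ≡ false
  none i with p (suc i) in pᵢ
  ... | false = refl
  ... | true with () ← unique p₀ pᵢ
... | false = sum-𝟙-unique (λ pᵢ pⱼ → suc-injective (unique pᵢ pⱼ))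

𝟙-∧-≤ : ∀ a b → 𝟙 (a ∧ b) ≤ 𝟙 b
𝟙-∧-≤ true  b = ≤-refl
𝟙-∧-≤ false b = z≤n

data PunchInView {m} (v : Fin (suc m)) : Fin (suc m) → Set where
  here  : PunchInView v v
  there : ∀ x → PunchInView v (punchIn v x)

punchInView : ∀ {m} (v u : Fin (suc m)) → PunchInView v u
punchInView v u with v ≟ u
... | yes refl = here
... | no v≢u   = subst (PunchInView v) (punchIn-punchOut v≢u) (there (punchOut v≢u))

countFin-punchIn : ∀ {m} (v : Fin (suc m)) (p : Fin (suc m) → Bool) →
  countFin p ≡ 𝟙 (p v) + ∑[ x < m ] 𝟙 (p (punchIn v x))
countFin-punchIn v p = trans (sum-map-allFin (𝟙 ∘ p)) (sum-remove (𝟙 ∘ p))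

degree-punchIn : ∀ {m} (G : Graph (suc m)) (v : Fin (suc m)) →
  degree G v ≡ ∑[ x < m ] 𝟙 (adj G v (punchIn v x))
degree-punchIn {m} G v =
  trans (countFin-punchIn v (adj G v))
        (cong (λ b → 𝟙 b + ∑[ x < m ] 𝟙 (adj G v (punchIn v x))) (irrefl G v))

module Induced {m n} (ι : Fin m → Fin n) (ι-inj : Injective _≡_ _≡_ ι) where

  graph : Graph n → Graph m
  graph G = record
    { adj    = λ x y → adj G (ι x) (ι y)
    ; sym    = λ x y → sym G (ι x) (ι y)
    ; irrefl = irrefl G ∘ ι
    }

  planar : {G : Graph n} → Planar G → Planar (graph G)
  planar P = record
    { pos      = pos ∘ ι
    ; pos-inj  = λ e → ι-inj (pos-inj e)
    ; vert-off = λ x y z xy z≢x z≢y →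
        vert-off (ι x) (ι y) (ι z) xy (z≢x ∘ ι-inj) (z≢y ∘ ι-inj)
    ; no-cross = λ x y z w xy zw x≢z x≢w y≢z y≢w →
        no-cross (ι x) (ι y) (ι z) (ι w) xy zw
          (x≢z ∘ ι-inj) (x≢w ∘ ι-inj) (y≢z ∘ ι-inj) (y≢w ∘ ι-inj)
    }
    where open PlaneDrawing P

  hasCycle : (G : Graph n) → ∀ k → HasCycle (graph G) k → HasCycle G k
  hasCycle G zero                   = id
  hasCycle G (suc zero)             = id
  hasCycle G (suc (suc zero))       = id
  hasCycle G (suc (suc (suc _))) (c , c-inj , c-adj) = ι ∘ c , (λ e → c-inj (ι-inj e)) , c-adj

  cover : {G : Graph n} {s : ℕ} → Cover G s → Cover (graph G) s
  cover H = record
    { hadj     = λ p q → hadj H (map₁ ι p) (map₁ ι q)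
    ; hsym     = λ p q → hsym H (map₁ ι p) (map₁ ι q)
    ; hirrefl  = hirrefl H ∘ map₁ ι
    ; fibre    = λ x → fibre H (ι x)
    ; non-edge = λ x y i j x≢y → non-edge H (ι x) (ι y) i j (x≢y ∘ ι-inj)
    ; matching = λ x y i j k x≢y → matching H (ι x) (ι y) i j k (x≢y ∘ ι-inj)
    }

module Delete {m} (v : Fin (suc m)) = Induced (punchIn v) (λ {x} {y} → punchIn-injective v x y)

fibreNeighbours≤adj : ∀ {n s} {G : Graph n} (H : Cover G s) {u w : Fin n} (c : Fin s) →
  w ≢ u → ∑[ i < s ] 𝟙 (hadj H (u , i) (w , c)) ≤ 𝟙 (adj G u w)
fibreNeighbours≤adj {G = G} H {u} {w} c w≢u with adj G u w in uw
... | false = ≤-reflexive (sum-𝟙-none (λ i → non-edge H u w i c (w≢u ∘ ≡.sym) uw))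
... | true  = sum-𝟙-unique (λ e₁ e₂ →
  matching H w u c _ _ w≢u (trans (hsym H _ _) e₁) (trans (hsym H _ _) e₂))

Before : ∀ {n} → (Fin n → Fin n) → Fin n → Fin n → Bool
Before ord w u = toℕ (ord w) <ᵇ toℕ (ord u)

backDegree : ∀ {n s} {G : Graph n} → Cover G s → (Fin n → Fin s) → (Fin n → Fin n) → Fin n → ℕ
backDegree H r ord u = countFin (λ w → Before ord w u ∧ hadj H (u , r u) (w , r w))

module Extension {m s} {G : Graph (suc m)} (H : Cover G s) (f : Fin s → Fin (suc m) → ℕ)
                 (v : Fin (suc m)) where
  open Delete v

  blocked : (Fin m → Fin s) → Fin s → ℕ
  blocked r′ i = ∑[ x < m ] 𝟙 (hadj H (v , i) (punchIn v x , r′ x))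

  sum-blocked≤degree : ∀ r′ → ∑[ i < s ] blocked r′ i ≤ degree G v
  sum-blocked≤degree r′ = begin
    ∑[ i < s ] ∑[ x < m ] 𝟙 (hadj H (v , i) (punchIn v x , r′ x))
      ≡⟨ ∑-comm (λ i x → 𝟙 (hadj H (v , i) (punchIn v x , r′ x))) ⟩
    ∑[ x < m ] ∑[ i < s ] 𝟙 (hadj H (v , i) (punchIn v x , r′ x))
      ≤⟨ sum-mono-≤ (λ x → fibreNeighbours≤adj H (r′ x) (punchInᵢ≢i v x)) ⟩
    ∑[ x < m ] 𝟙 (adj G v (punchIn v x))
      ≡⟨ degree-punchIn G v ⟨
    degree G v ∎
    where open ≤-Reasoning

  freeColor : ∀ r′ → degree G v < fsum f v → ∃ λ i → blocked r′ i < f i v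
  freeColor r′ deg<|f| = sum-<⇒∃-< (begin-strict
    ∑[ i < s ] blocked r′ i  ≤⟨ sum-blocked≤degree r′ ⟩
    degree G v              <⟨ deg<|f| ⟩
    fsum f v                ≡⟨ sum-map-allFin (λ i → f i v) ⟩
    ∑[ i < s ] f i v        ∎)
    where open ≤-Reasoning

  module Insert (r′ : Fin m → Fin s) (ord′ : Fin m → Fin m) (i : Fin s) where

    r : Fin (suc m) → Fin s
    r = insertAt r′ v i

    ord : Fin (suc m) → Fin (suc m)
    ord = insertAt (inject₁ ∘ ord′) v (fromℕ m)

    ord-v : ord v ≡ fromℕ m
    ord-v = insertAt-lookup (inject₁ ∘ ord′) v (fromℕ m)

    ord-punchIn : ∀ x → ord (punchIn v x) ≡ inject₁ (ord′ x)
    ord-punchIn = insertAt-punchIn (inject₁ ∘ ord′) v (fromℕ m)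

    r-punchIn : ∀ x → r (punchIn v x) ≡ r′ x
    r-punchIn = insertAt-punchIn r′ v i

    ord-v≢ord-punchIn : ∀ x → ord v ≢ ord (punchIn v x)
    ord-v≢ord-punchIn x e = fromℕ≢inject₁ (trans (≡.sym ord-v) (trans e (ord-punchIn x)))

    ord-injective : Injective _≡_ _≡_ ord′ → Injective _≡_ _≡_ ord
    ord-injective ord′-inj {u} {w} e with punchInView v u | punchInView v w
    ... | here    | here    = refl
    ... | here    | there y = contradiction e (ord-v≢ord-punchIn y)
    ... | there x | here    = contradiction (≡.sym e) (ord-v≢ord-punchIn x)
    ... | there x | there y = cong (punchIn v) (ord′-inj (inject₁-injective
      (trans (≡.sym (ord-punchIn x)) (trans e (ord-punchIn y)))))

    toℕ-ord-punchIn : ∀ x → toℕ (ord (punchIn v x)) ≡ toℕ (ord′ x)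
    toℕ-ord-punchIn x = trans (cong toℕ (ord-punchIn x)) (toℕ-inject₁ (ord′ x))

    backDegree-v : backDegree H r ord v ≤ blocked r′ i
    backDegree-v = begin
      backDegree H r ord v
        ≡⟨ countFin-punchIn v q ⟩
      𝟙 (q v) + ∑[ x < m ] 𝟙 (q (punchIn v x))
        ≡⟨ cong (λ b → 𝟙 b + ∑[ x < m ] 𝟙 (q (punchIn v x))) q-v ⟩
      ∑[ x < m ] 𝟙 (q (punchIn v x))
        ≤⟨ sum-mono-≤ (λ x → 𝟙-∧-≤ (Before ord (punchIn v x) v) _) ⟩
      ∑[ x < m ] 𝟙 (hadj H (v , r v) (punchIn v x , r (punchIn v x)))
        ≡⟨ sum-cong-≗ (λ x → cong₂ (λ c d → 𝟙 (hadj H (v , c) (punchIn v x , d)))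
                                   (insertAt-lookup r′ v i) (r-punchIn x)) ⟩
      blocked r′ i ∎
      where
      open ≤-Reasoning
      q : Fin (suc m) → Bool
      q w = Before ord w v ∧ hadj H (v , r v) (w , r w)
      q-v : q v ≡ false
      q-v = trans (cong (Before ord v v ∧_) (hirrefl H (v , r v))) (∧-zeroʳ _)

    backDegree-punchIn : ∀ x → backDegree H r ord (punchIn v x) ≡ backDegree (cover H) r′ ord′ x
    backDegree-punchIn x = begin
      backDegree H r ord (punchIn v x)
        ≡⟨ countFin-punchIn v q ⟩
      𝟙 (q v) + ∑[ y < m ] 𝟙 (q (punchIn v y))
        ≡⟨ cong₂ _+_ (cong 𝟙 q-v) (sum-cong-≗ (cong 𝟙 ∘ q-punchIn)) ⟩
      ∑[ y < m ] 𝟙 (q′ y)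
        ≡⟨ sum-map-allFin (𝟙 ∘ q′) ⟨
      backDegree (cover H) r′ ord′ x ∎
      where
      open ≡.≡-Reasoning
      q : Fin (suc m) → Bool
      q w = Before ord w (punchIn v x) ∧ hadj H (punchIn v x , r (punchIn v x)) (w , r w)
      q′ : Fin m → Bool
      q′ y = Before ord′ y x ∧ hadj H (punchIn v x , r′ x) (punchIn v y , r′ y)
      v-not-before : Before ord v (punchIn v x) ≡ false
      v-not-before = trans (cong₂ _<ᵇ_ (trans (cong toℕ ord-v) (toℕ-fromℕ m)) (toℕ-ord-punchIn x))
                           (dec-false (m <? toℕ (ord′ x)) (<⇒≯ (toℕ<n (ord′ x))))
      q-v : q v ≡ false
      q-v = cong (_∧ hadj H (punchIn v x , r (punchIn v x)) (v , r v)) v-not-before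
      q-punchIn : ∀ y → q (punchIn v y) ≡ q′ y
      q-punchIn y = cong₂ _∧_ (cong₂ _<ᵇ_ (toℕ-ord-punchIn y) (toℕ-ord-punchIn x))
        (cong₂ (λ c d → hadj H (punchIn v x , c) (punchIn v y , d)) (r-punchIn x) (r-punchIn y))

    coloring : Injective _≡_ _≡_ ord′ →
               (∀ x → backDegree (cover H) r′ ord′ x < f (r′ x) (punchIn v x)) →
               blocked r′ i < f i v → DPFColoring G H f
    coloring ord′-inj r′-ok i-free = r , ord , ord-injective ord′-inj , ok
      where
      ok : ∀ u → backDegree H r ord u < f (r u) u
      ok u with punchInView v u
      ... | here    = subst (λ c → backDegree H r ord v < f c v) (≡.sym (insertAt-lookup r′ v i))
                            (≤-<-trans backDegree-v i-free)
      ... | there x = subst₂ _<_ (≡.sym (backDegree-punchIn x))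
                             (cong (λ c → f c (punchIn v x)) (≡.sym (r-punchIn x))) (r′-ok x)

  extend : degree G v < fsum f v →
           DPFColoring (graph G) (cover H) (λ i → removeAt (f i) v) → DPFColoring G H f
  extend deg<|f| (r′ , ord′ , ord′-inj , r′-ok) =
    let i , i-free = freeColor r′ deg<|f| in Insert.coloring r′ ord′ i ord′-inj r′-ok i-free

smallerCounterexample : ∀ {a b} (C : Counterexample a b) (v : Fin (Counterexample.n C)) →
  degree (Counterexample.G C) v < fsum (Counterexample.f C) v →
  ∃ λ (C′ : Counterexample a b) → Counterexample.n C′ < Counterexample.n C
smallerCounterexample {a} {b} record
  { n = suc m ; G = G ; planar = P ; no-C4 = no-C4 ; no-Ca = no-Ca ; no-Cb = no-Cb ; no-C9 = no-C9
  ; s = s ; s≥1 = s≥1 ; H = H ; f = f ; f≤2 = f≤2 ; |f|≥3 = |f|≥3 ; no-col = no-col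
  } v deg<|f| = C′ , ≤-refl
  where
  open Delete v
  C′ : Counterexample a b
  C′ = record
    { n = m ; G = graph G ; planar = planar P
    ; no-C4 = no-C4 ∘ hasCycle G 4 ; no-Ca = no-Ca ∘ hasCycle G a ; no-Cb = no-Cb ∘ hasCycle G b
    ; no-C9 = no-C9 ∘ hasCycle G 9
    ; s = s ; s≥1 = s≥1 ; H = cover H ; f = λ i → removeAt (f i) v
    ; f≤2 = λ i → f≤2 i ∘ punchIn v ; |f|≥3 = |f|≥3 ∘ punchIn v
    ; no-col = no-col ∘ Extension.extend H f v deg<|f|
    }

lemma2 : (a b : ℕ) → (a ≡ 6 ⊎ a ≡ 7 ⊎ a ≡ 8) → (b ≡ 6 ⊎ b ≡ 7 ⊎ b ≡ 8) → a ≢ b →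
    (C : Counterexample a b) →
    (∀ (C′ : Counterexample a b) → Counterexample.n C ≤ Counterexample.n C′) →
    ∀ (v : Fin (Counterexample.n C)) → 3 ≤ degree (Counterexample.G C) v
lemma2 a b _ _ _ C minimal v with 3 ≤? degree (Counterexample.G C) v
... | yes 3≤deg = 3≤deg
... | no  3≰deg =
  let C′ , C′<C = smallerCounterexample C v (<-≤-trans (≰⇒> 3≰deg) (Counterexample.|f|≥3 C v))
  in  contradiction (minimal C′) (<⇒≱ C′<C)
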